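{- Let $r\ge0$ be an integer and let $H$ be a turnpike of toll $r$ from $a$ to $b$. Then the persistent price and the visiting price of $b$ in $H$ both equal $r+2$, and the persistent price and the visiting price of $b$ in the subgraph $H-a$ (induced on all vertices except $a$) both equal $r+1$.
   Context: The molding $\mathrm{Mold}(G)$ of a DAG $G$ has vertex set $\{s\}\cup\{v^{\mathrm{in}},v^{\mathrm{out}}:v\in V(G)\}$ and edges $(v^{\mathrm{in}},v^{\mathrm{out}})$ for $v\in V(G)$, $(u^{\mathrm{out}},v^{\mathrm{in}})$ for each edge $(u,v)$ of $G$, and $(s,v^{\mathrm{out}})$ for $v\in V(G)$. A turnpike of toll $0$ from $a$ to $b$ is the graph with the single edge $(a,b)$. For $r\ge1$, a turnpike of toll $r$ from $a$ to $b$ is $\mathrm{Mold}(T_r)$, where $T_r$ is a single-sink DAG whose visiting price and persistent price both equal $r$, with $a$ being the special source $s$ and $b$ the unique sink of $\mathrm{Mold}(T_r)$. A reversible pebbling is a sequence of vertex sets $P_0,\dots,P_\tau$, each obtained from the previous by placing a pebble on $v\notin P$ with all predecessors of $v$ in $P$, or removing a pebble from $v\in P$ with all predecessors of $v$ in $P$; its space is $\max_t|P_t|$. For a vertex $v$ of a DAG, the persistent price of $v$ is the minimum space of a reversible pebbling with $P_0=\emptyset$ and $P_\tau=\{v\}$, and the visiting price of $v$ is the minimum space of a reversible pebbling with $P_0=\emptyset$ and $v\in P_\tau$. -}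

module Defs where

open import Data.Nat using (ℕ; zero; suc; _+_; _⊔_; _≤_)
open import Data.Fin using (Fin; zero; suc; _↑ˡ_; _↑ʳ_; punchIn)
open import Data.Fin.Subset using (Subset; inside; outside; _∈_; _∉_; ∣_∣; ⁅_⁆) renaming (⊥ to ∅)
open import Data.Vec using (_[_]≔_)
open import Data.Product using (Σ; _×_; _,_)
open import Data.Sum using (_⊎_)
open import Relation.Nullary using (¬_)
open import Relation.Binary.PropositionalEquality using (_≡_)
open import Relation.Binary.Construct.Closure.Transitive using (TransClosure)

record Graph (n : ℕ) : Set₁ where
  field
    E : Fin n → Fin n → Set
open Graph public

Acyclic : ∀ {n} → Graph n → Set
Acyclic G = ∀ v → ¬ TransClosure (E G) v v

IsSink : ∀ {n} → Graph n → Fin n → Set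
IsSink G v = ∀ u → ¬ E G v u

UniqueSink : ∀ {n} → Graph n → Fin n → Set
UniqueSink G t = IsSink G t × (∀ w → IsSink G w → w ≡ t)

PredsIn : ∀ {n} → Graph n → Subset n → Fin n → Set
PredsIn G P v = ∀ u → E G u v → u ∈ P

data Step {n} (G : Graph n) (P : Subset n) : Subset n → Set where
  place  : ∀ v → v ∉ P → PredsIn G P v → Step G P (P [ v ]≔ inside)
  remove : ∀ v → v ∈ P → PredsIn G P v → Step G P (P [ v ]≔ outside)

data Pebbling {n} (G : Graph n) : Subset n → Subset n → ℕ → Set where
  done : ∀ {P} → Pebbling G P P ∣ P ∣
  step : ∀ {P Q R s} → Step G P Q → Pebbling G Q R s → Pebbling G P R (∣ P ∣ ⊔ s)

PersistentPrice : ∀ {n} → Graph n → Fin n → ℕ → Set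
PersistentPrice G v k =
  Pebbling G ∅ ⁅ v ⁆ k × (∀ s → Pebbling G ∅ ⁅ v ⁆ s → k ≤ s)

VisitingPrice : ∀ {n} → Graph n → Fin n → ℕ → Set
VisitingPrice G v k =
  Σ (Subset _) (λ Q → v ∈ Q × Pebbling G ∅ Q k)
  × (∀ Q s → v ∈ Q → Pebbling G ∅ Q s → k ≤ s)

-- Molding.  Vertices of Mold G (G on Fin n) are Fin (suc (n + n)):
--   zero             = s
--   suc (v ↑ˡ n)     = v^in
--   suc (n ↑ʳ v)     = v^out

moldS : ∀ {n} → Fin (suc (n + n))
moldS = zero

inV : ∀ {n} → Fin n → Fin (suc (n + n))
inV {n} v = suc (v ↑ˡ n)

outV : ∀ {n} → Fin n → Fin (suc (n + n))
outV {n} v = suc (n ↑ʳ v)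

data MoldE {n} (G : Graph n) : Fin (suc (n + n)) → Fin (suc (n + n)) → Set where
  in-out  : ∀ v → MoldE G (inV {n} v) (outV {n} v)
  out-in  : ∀ u v → E G u v → MoldE G (outV {n} u) (inV {n} v)
  src-out : ∀ v → MoldE G (moldS {n}) (outV {n} v)

Mold : ∀ {n} → Graph n → Graph (suc (n + n))
Mold G = record { E = MoldE G }

deleteVertex : ∀ {m} → Graph (suc m) → Fin (suc m) → Graph m
deleteVertex G x = record { E = λ i j → E G (punchIn x i) (punchIn x j) }

data SingleEdge : Fin 2 → Fin 2 → Set where
  edge : SingleEdge zero (suc zero)

singleEdgeGraph : Graph 2
singleEdgeGraph = record { E = SingleEdge }

data Turnpike : (r : ℕ) → ∀ {m} → Graph (suc m) → Fin (suc m) → Fin (suc m) → Set₁ where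
  toll0 : Turnpike 0 singleEdgeGraph zero (suc zero)
  tollS : ∀ {r n} (T : Graph n) (t : Fin n) →
          Acyclic T → UniqueSink T t →
          VisitingPrice T t (suc r) → PersistentPrice T t (suc r) →
          UniqueSink (Mold T) (outV {n} t) →
          Turnpike (suc r) (Mold T) (moldS {n}) (outV {n} t)

-- Write M⁻ for Mold T with its source s deleted, so b = t^out. A pebbling of T of space c
-- becomes one of M⁻ of space c + 1 by replaying each move on v at v^out while v^in is
-- pebbled, and one of Mold T of space c + 2 by also pebbling s during every move.
-- Conversely, deleting s maps configurations of Mold T to those of M⁻, and merging v^in
-- with v^out maps configurations of M⁻ to those of T. Neither map adds pebbles, each move
-- maps to a move or to nothing, and at a local maximum of the pebbling the placement
-- reaching it and the removal leaving it commute in the image; so the image pebbling uses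
-- one pebble less whenever its final configuration is smaller than the original one.
-- When t^out is first pebbled, so are t^in and, in Mold T, also s, which makes both
-- images smaller there; the visiting price c of t in T then bounds everything below.
module Submission where

open import Defs
open import Data.Bool using (_∨_)
open import Data.Bool.Properties using (∨-zeroʳ; ∨-identityʳ)
open import Data.Empty using (⊥-elim)
open import Data.Fin using (Fin; zero; suc; punchIn; _↑ˡ_; _↑ʳ_; _≟_)
open import Data.Fin.Properties using (suc-injective; ↑ˡ-injective; ↑ʳ-injective)
open import Data.Fin.Subset
  using (Subset; inside; outside; _∈_; _∉_; ∣_∣; ⁅_⁆; _∪_; _∩_) renaming (⊥ to ∅)
open import Data.Fin.Subset.Properties
  using (∣⊥∣≡0; x∈⁅x⁆; ∉⊥; drop-there; ∣p∣≤∣x∷p∣; _∈?_; ∪-idem;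
         x∈p∪q⁺; x∈p∪q⁻; x∈p∩q⁺; x∈p⇒∣p-x∣<∣p∣)
open import Data.Nat using (ℕ; zero; suc; _+_; _⊔_; _≤_; _<_; z≤n; s≤s; _≤?_)
open import Data.Nat.Properties
  using (≤-refl; ≤-reflexive; ≤-trans; ≤-antisym; ≤-pred; ≤-<-trans; <-≤-trans; <-irrefl;
         ≤⇒≯; ≰⇒>; n≤1+n; n<1+n; 1+n≢n; m≤n⇒m≤1+n; m≤m+n; m<m+n; +-suc; +-comm;
         m≤m⊔n; m≤n⊔m; ⊔-lub; ⊔-monoʳ-≤; m⊔n≤o⇒m≤o; m⊔n≤o⇒n≤o)
open import Data.Product using (∃-syntax; ∃₂; _×_; _,_; proj₁; proj₂)
open import Data.Sum using (_⊎_; inj₁; inj₂; [_,_])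
open import Data.Vec using (Vec; []; _∷_; _++_; tail; take; drop; splitAt; _[_]≔_; here; there)
open import Data.Vec.Properties
  using ([]=-injective; []≔-updates; []≔-minimal; []≔-idempotent; []≔-commutes;
         []≔-++-↑ˡ; []≔-++-↑ʳ)
open import Function using (_∘_)
open import Relation.Binary.Construct.Closure.Transitive using () renaming ([_] to [_]⁺)
open import Relation.Binary.PropositionalEquality
  using (_≡_; _≢_; refl; sym; trans; cong; cong₂; subst; subst₂; module ≡-Reasoning)
open import Relation.Nullary using (¬_; yes; no; contradiction)

private
  variable
    m n k s c : ℕ

x∈p⇒0<∣p∣ : ∀ {x} {p : Subset n} → x ∈ p → 0 < ∣ p ∣
x∈p⇒0<∣p∣ x∈p = ≤-<-trans z≤n (x∈p⇒∣p-x∣<∣p∣ x∈p)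

∈-[]≔⁻ : ∀ (p : Subset n) {x y b} → y ∈ p [ x ]≔ b → y ≢ x → y ∈ p
∈-[]≔⁻ (_ ∷ _) {zero} {zero} _ y≢x = contradiction refl y≢x
∈-[]≔⁻ (_ ∷ _) {suc _} {zero} here _ = here
∈-[]≔⁻ (_ ∷ p) {zero} {suc _} (there y∈) _ = there y∈
∈-[]≔⁻ (_ ∷ p) {suc _} {suc _} (there y∈) y≢x = there (∈-[]≔⁻ p y∈ (y≢x ∘ cong suc))

∉-[]≔outside : ∀ (p : Subset n) {x y} → x ∉ p → x ∉ p [ y ]≔ outside
∉-[]≔outside p {x} {y} x∉ x∈ with x ≟ y
... | yes refl with []=-injective x∈ ([]≔-updates p x)
...   | ()
∉-[]≔outside p {x} {y} x∉ x∈ | no x≢y = x∉ (∈-[]≔⁻ p x∈ x≢y)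

[]≔outside-∉ : ∀ (p : Subset n) {x} → x ∉ p → p [ x ]≔ outside ≡ p
[]≔outside-∉ (inside ∷ p) {zero} x∉ = contradiction here x∉
[]≔outside-∉ (outside ∷ p) {zero} _ = refl
[]≔outside-∉ (b ∷ p) {suc x} x∉ = cong (b ∷_) ([]≔outside-∉ p (x∉ ∘ there))

∣p[x]≔inside∣≡1+∣p∣ : ∀ (p : Subset n) {x} → x ∉ p → ∣ p [ x ]≔ inside ∣ ≡ suc ∣ p ∣
∣p[x]≔inside∣≡1+∣p∣ (inside ∷ p) {zero} x∉ = contradiction here x∉
∣p[x]≔inside∣≡1+∣p∣ (outside ∷ p) {zero} _ = refl
∣p[x]≔inside∣≡1+∣p∣ (inside ∷ p) {suc x} x∉ = cong suc (∣p[x]≔inside∣≡1+∣p∣ p (x∉ ∘ there))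
∣p[x]≔inside∣≡1+∣p∣ (outside ∷ p) {suc x} x∉ = ∣p[x]≔inside∣≡1+∣p∣ p (x∉ ∘ there)

1+∣p[x]≔outside∣≡∣p∣ : ∀ {p : Subset n} {x} → x ∈ p → suc ∣ p [ x ]≔ outside ∣ ≡ ∣ p ∣
1+∣p[x]≔outside∣≡∣p∣ here = refl
1+∣p[x]≔outside∣≡∣p∣ {p = inside ∷ _} (there x∈) = cong suc (1+∣p[x]≔outside∣≡∣p∣ x∈)
1+∣p[x]≔outside∣≡∣p∣ {p = outside ∷ _} (there x∈) = 1+∣p[x]≔outside∣≡∣p∣ x∈

∣p++q∣≡∣p∣+∣q∣ : ∀ (p : Subset m) (q : Subset n) → ∣ p ++ q ∣ ≡ ∣ p ∣ + ∣ q ∣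
∣p++q∣≡∣p∣+∣q∣ [] q = refl
∣p++q∣≡∣p∣+∣q∣ (inside ∷ p) q = cong suc (∣p++q∣≡∣p∣+∣q∣ p q)
∣p++q∣≡∣p∣+∣q∣ (outside ∷ p) q = ∣p++q∣≡∣p∣+∣q∣ p q

∣⊥++p∣≡∣p∣ : ∀ m (p : Subset n) → ∣ ∅ {m} ++ p ∣ ≡ ∣ p ∣
∣⊥++p∣≡∣p∣ zero p = refl
∣⊥++p∣≡∣p∣ (suc m) p = ∣⊥++p∣≡∣p∣ m p

∣⊥[x]≔inside++p∣≡1+∣p∣ : ∀ (x : Fin m) (p : Subset n) →
                         ∣ (∅ [ x ]≔ inside) ++ p ∣ ≡ suc ∣ p ∣
∣⊥[x]≔inside++p∣≡1+∣p∣ {suc m} zero p = cong suc (∣⊥++p∣≡∣p∣ m p)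
∣⊥[x]≔inside++p∣≡1+∣p∣ (suc x) p = ∣⊥[x]≔inside++p∣≡1+∣p∣ x p

∣p∪q∣+∣p∩q∣≡∣p∣+∣q∣ : ∀ (p q : Subset n) → ∣ p ∪ q ∣ + ∣ p ∩ q ∣ ≡ ∣ p ∣ + ∣ q ∣
∣p∪q∣+∣p∩q∣≡∣p∣+∣q∣ [] [] = refl
∣p∪q∣+∣p∩q∣≡∣p∣+∣q∣ (inside ∷ p) (inside ∷ q) =
  cong suc (trans (+-suc _ _) (trans (cong suc (∣p∪q∣+∣p∩q∣≡∣p∣+∣q∣ p q)) (sym (+-suc _ _))))
∣p∪q∣+∣p∩q∣≡∣p∣+∣q∣ (inside ∷ p) (outside ∷ q) = cong suc (∣p∪q∣+∣p∩q∣≡∣p∣+∣q∣ p q)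
∣p∪q∣+∣p∩q∣≡∣p∣+∣q∣ (outside ∷ p) (inside ∷ q) =
  trans (cong suc (∣p∪q∣+∣p∩q∣≡∣p∣+∣q∣ p q)) (sym (+-suc _ _))
∣p∪q∣+∣p∩q∣≡∣p∣+∣q∣ (outside ∷ p) (outside ∷ q) = ∣p∪q∣+∣p∩q∣≡∣p∣+∣q∣ p q

∪-[]≔ˡ : ∀ (p q : Subset n) {x} b → x ∉ q → (p [ x ]≔ b) ∪ q ≡ (p ∪ q) [ x ]≔ b
∪-[]≔ˡ (_ ∷ p) (inside ∷ q) {zero} b x∉ = contradiction here x∉
∪-[]≔ˡ (_ ∷ p) (outside ∷ q) {zero} b _ = cong (_∷ p ∪ q) (∨-identityʳ b)
∪-[]≔ˡ (a ∷ p) (d ∷ q) {suc x} b x∉ = cong ((a ∨ d) ∷_) (∪-[]≔ˡ p q b (x∉ ∘ there))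

∪-[]≔ˡ-covered : ∀ (p : Subset n) {q x} b → x ∈ q → (p [ x ]≔ b) ∪ q ≡ p ∪ q
∪-[]≔ˡ-covered (a ∷ p) b here = cong (_∷ p ∪ _) (trans (∨-zeroʳ b) (sym (∨-zeroʳ a)))
∪-[]≔ˡ-covered (a ∷ p) b (there x∈) = cong (_ ∷_) (∪-[]≔ˡ-covered p b x∈)

∪-[]≔ʳ-covered : ∀ {p : Subset n} (q : Subset n) {x} b → x ∈ p → p ∪ (q [ x ]≔ b) ≡ p ∪ q
∪-[]≔ʳ-covered (_ ∷ q) b here = refl
∪-[]≔ʳ-covered (_ ∷ q) b (there x∈) = cong (_ ∷_) (∪-[]≔ʳ-covered q b x∈)

∈-++⁺ˡ : ∀ {p : Subset m} {q : Subset n} {x} → x ∈ p → x ↑ˡ n ∈ p ++ q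
∈-++⁺ˡ here = here
∈-++⁺ˡ (there x∈) = there (∈-++⁺ˡ x∈)

∈-++⁺ʳ : ∀ (p : Subset m) {q : Subset n} {x} → x ∈ q → m ↑ʳ x ∈ p ++ q
∈-++⁺ʳ [] x∈ = x∈
∈-++⁺ʳ (_ ∷ p) x∈ = there (∈-++⁺ʳ p x∈)

∈-++⁻ˡ : ∀ (p : Subset m) {q : Subset n} {x} → x ↑ˡ n ∈ p ++ q → x ∈ p
∈-++⁻ˡ (_ ∷ p) {x = zero} here = here
∈-++⁻ˡ (_ ∷ p) {x = suc x} (there x∈) = there (∈-++⁻ˡ p x∈)

∈-++⁻ʳ : ∀ (p : Subset m) {q : Subset n} {x} → m ↑ʳ x ∈ p ++ q → x ∈ q
∈-++⁻ʳ [] x∈ = x∈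
∈-++⁻ʳ (_ ∷ p) (there x∈) = ∈-++⁻ʳ p x∈

⊥++⊥≡⊥ : ∀ m n → ∅ {m} ++ ∅ {n} ≡ ∅
⊥++⊥≡⊥ zero n = refl
⊥++⊥≡⊥ (suc m) n = cong (outside ∷_) (⊥++⊥≡⊥ m n)

⊥++⁅x⁆≡⁅m↑ʳx⁆ : ∀ m (x : Fin n) → ∅ {m} ++ ⁅ x ⁆ ≡ ⁅ m ↑ʳ x ⁆
⊥++⁅x⁆≡⁅m↑ʳx⁆ zero x = refl
⊥++⁅x⁆≡⁅m↑ʳx⁆ (suc m) x = cong (outside ∷_) (⊥++⁅x⁆≡⁅m↑ʳx⁆ m x)

∣tail∣≤ : ∀ (P : Subset (suc n)) → ∣ tail P ∣ ≤ ∣ P ∣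
∣tail∣≤ (b ∷ P) = ∣p∣≤∣x∷p∣ b P

∣tail∣< : ∀ {P : Subset (suc n)} → zero ∈ P → ∣ tail P ∣ < ∣ P ∣
∣tail∣< here = n<1+n _

∈-tail : ∀ {P : Subset (suc n)} {x} → suc x ∈ P → x ∈ tail P
∈-tail {P = _ ∷ _} = drop-there

↑ˡ≢↑ʳ : ∀ (v : Fin m) (w : Fin n) → v ↑ˡ n ≢ m ↑ʳ w
↑ˡ≢↑ʳ zero w ()
↑ˡ≢↑ʳ (suc v) w eq = ↑ˡ≢↑ʳ v w (suc-injective eq)

data Split (m n : ℕ) : Fin (m + n) → Set where
  left  : ∀ v → Split m n (v ↑ˡ n)
  right : ∀ v → Split m n (m ↑ʳ v)

split : ∀ m n (i : Fin (m + n)) → Split m n i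
split zero n i = right i
split (suc m) n zero = left zero
split (suc m) n (suc i) with split m n i
... | left v = left (suc v)
... | right v = right v

-- Merging the two halves of Fin (n + n)

take-++ : ∀ {A : Set} (xs : Vec A m) (ys : Vec A n) → take m (xs ++ ys) ≡ xs
take-++ [] ys = refl
take-++ (x ∷ xs) ys = cong (x ∷_) (take-++ xs ys)

drop-++ : ∀ {A : Set} (xs : Vec A m) (ys : Vec A n) → drop m (xs ++ ys) ≡ ys
drop-++ [] ys = refl
drop-++ (x ∷ xs) ys = drop-++ xs ys

data Halves (m n : ℕ) : Subset (m + n) → Set where
  halves : ∀ (a : Subset m) (b : Subset n) → Halves m n (a ++ b)

halve : ∀ m {n} (P : Subset (m + n)) → Halves m n P
halve m P with splitAt m P
... | a , b , refl = halves a b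

shadow : ∀ n → Subset (n + n) → Subset n
shadow n P = take n P ∪ drop n P

shadow-++ : ∀ (a b : Subset n) → shadow n (a ++ b) ≡ a ∪ b
shadow-++ a b = cong₂ _∪_ (take-++ a b) (drop-++ a b)

shadow-∅ : ∀ n → shadow n ∅ ≡ ∅
shadow-∅ n = trans (cong (shadow n) (sym (⊥++⊥≡⊥ n n))) (trans (shadow-++ ∅ ∅) (∪-idem ∅))

∣shadow-++∣+∣∩∣≡∣++∣ : ∀ (a b : Subset n) → ∣ shadow n (a ++ b) ∣ + ∣ a ∩ b ∣ ≡ ∣ a ++ b ∣
∣shadow-++∣+∣∩∣≡∣++∣ {n} a b = begin
  ∣ shadow n (a ++ b) ∣ + ∣ a ∩ b ∣  ≡⟨ cong (λ X → ∣ X ∣ + ∣ a ∩ b ∣) (shadow-++ a b) ⟩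
  ∣ a ∪ b ∣ + ∣ a ∩ b ∣             ≡⟨ ∣p∪q∣+∣p∩q∣≡∣p∣+∣q∣ a b ⟩
  ∣ a ∣ + ∣ b ∣                     ≡⟨ ∣p++q∣≡∣p∣+∣q∣ a b ⟨
  ∣ a ++ b ∣                        ∎
  where open ≡-Reasoning

∣shadow∣≤ : ∀ (P : Subset (n + n)) → ∣ shadow n P ∣ ≤ ∣ P ∣
∣shadow∣≤ {n} P with halve n P
... | halves a b = ≤-trans (m≤m+n _ _) (≤-reflexive (∣shadow-++∣+∣∩∣≡∣++∣ a b))

∣shadow∣< : ∀ {P : Subset (n + n)} {v} → v ↑ˡ n ∈ P → n ↑ʳ v ∈ P → ∣ shadow n P ∣ < ∣ P ∣
∣shadow∣< {n} {P} i∈ o∈ with halve n P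
... | halves a b =
  <-≤-trans (m<m+n _ (x∈p⇒0<∣p∣ (x∈p∩q⁺ (∈-++⁻ˡ a i∈ , ∈-++⁻ʳ a o∈))))
            (≤-reflexive (∣shadow-++∣+∣∩∣≡∣++∣ a b))

∈-shadowˡ : ∀ {P : Subset (n + n)} {v} → v ↑ˡ n ∈ P → v ∈ shadow n P
∈-shadowˡ {n} {P} i∈ with halve n P
... | halves a b = subst (_ ∈_) (sym (shadow-++ a b)) (x∈p∪q⁺ (inj₁ (∈-++⁻ˡ a i∈)))

∈-shadowʳ : ∀ {P : Subset (n + n)} {v} → n ↑ʳ v ∈ P → v ∈ shadow n P
∈-shadowʳ {n} {P} o∈ with halve n P
... | halves a b = subst (_ ∈_) (sym (shadow-++ a b)) (x∈p∪q⁺ (inj₂ (∈-++⁻ʳ a o∈)))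

∉-shadow : ∀ {P : Subset (n + n)} {v} → v ↑ˡ n ∉ P → n ↑ʳ v ∉ P → v ∉ shadow n P
∉-shadow {n} {P} i∉ o∉ v∈ with halve n P
... | halves a b =
  [ i∉ ∘ ∈-++⁺ˡ , o∉ ∘ ∈-++⁺ʳ a ] (x∈p∪q⁻ a b (subst (_ ∈_) (shadow-++ a b) v∈))

shadow-[↑ˡ]≔ : ∀ {P : Subset (n + n)} {v} b → n ↑ʳ v ∉ P →
               shadow n (P [ v ↑ˡ n ]≔ b) ≡ shadow n P [ v ]≔ b
shadow-[↑ˡ]≔ {n} {P} {v} x o∉ with halve n P
... | halves a b = begin
  shadow n ((a ++ b) [ v ↑ˡ n ]≔ x)  ≡⟨ cong (shadow n) ([]≔-++-↑ˡ a b v) ⟩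
  shadow n ((a [ v ]≔ x) ++ b)       ≡⟨ shadow-++ _ b ⟩
  (a [ v ]≔ x) ∪ b                   ≡⟨ ∪-[]≔ˡ a b x (o∉ ∘ ∈-++⁺ʳ a) ⟩
  (a ∪ b) [ v ]≔ x                   ≡⟨ cong (_[ v ]≔ x) (shadow-++ a b) ⟨
  shadow n (a ++ b) [ v ]≔ x         ∎
  where open ≡-Reasoning

shadow-[↑ˡ]≔-covered : ∀ {P : Subset (n + n)} {v} b → n ↑ʳ v ∈ P →
                       shadow n (P [ v ↑ˡ n ]≔ b) ≡ shadow n P
shadow-[↑ˡ]≔-covered {n} {P} {v} x o∈ with halve n P
... | halves a b = begin
  shadow n ((a ++ b) [ v ↑ˡ n ]≔ x)  ≡⟨ cong (shadow n) ([]≔-++-↑ˡ a b v) ⟩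
  shadow n ((a [ v ]≔ x) ++ b)       ≡⟨ shadow-++ _ b ⟩
  (a [ v ]≔ x) ∪ b                   ≡⟨ ∪-[]≔ˡ-covered a x (∈-++⁻ʳ a o∈) ⟩
  a ∪ b                              ≡⟨ shadow-++ a b ⟨
  shadow n (a ++ b)                  ∎
  where open ≡-Reasoning

shadow-[↑ʳ]≔-covered : ∀ {P : Subset (n + n)} {v} b → v ↑ˡ n ∈ P →
                       shadow n (P [ n ↑ʳ v ]≔ b) ≡ shadow n P
shadow-[↑ʳ]≔-covered {n} {P} {v} x i∈ with halve n P
... | halves a b = begin
  shadow n ((a ++ b) [ n ↑ʳ v ]≔ x)  ≡⟨ cong (shadow n) ([]≔-++-↑ʳ a b v) ⟩
  shadow n (a ++ (b [ v ]≔ x))       ≡⟨ shadow-++ a _ ⟩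
  a ∪ (b [ v ]≔ x)                   ≡⟨ ∪-[]≔ʳ-covered b x (∈-++⁻ˡ a i∈) ⟩
  a ∪ b                              ≡⟨ shadow-++ a b ⟨
  shadow n (a ++ b)                  ∎
  where open ≡-Reasoning

Loopless : Graph n → Set
Loopless G = ∀ v → ¬ E G v v

Pebbling≤ : Graph n → Subset n → Subset n → ℕ → Set
Pebbling≤ G P R s = ∃[ k ] (Pebbling G P R k × k ≤ s)

VisitBound : Graph n → Fin n → ℕ → Set
VisitBound G v c = ∀ Q s → v ∈ Q → Pebbling G ∅ Q s → c ≤ s

module _ {G : Graph n} where

  start≤ : ∀ {P R} → Pebbling G P R k → ∣ P ∣ ≤ k
  start≤ done = ≤-refl
  start≤ (step _ _) = m≤m⊔n _ _

  end≤ : ∀ {P R} → Pebbling G P R k → ∣ R ∣ ≤ k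
  end≤ done = ≤-refl
  end≤ {P = P} (step _ p) = ≤-trans (end≤ p) (m≤n⊔m ∣ P ∣ _)

  done≤ : ∀ {P} → ∣ P ∣ ≤ s → Pebbling≤ G P P s
  done≤ P≤s = _ , done , P≤s

  step≤ : ∀ {P Q R} → Step G P Q → ∣ P ∣ ≤ s → Pebbling≤ G Q R s → Pebbling≤ G P R s
  step≤ st P≤s (_ , p , k≤s) = _ , step st p , ⊔-lub P≤s k≤s

  step?≤ : ∀ {P Q R} → P ≡ Q ⊎ Step G P Q → ∣ P ∣ ≤ s →
           Pebbling≤ G Q R s → Pebbling≤ G P R s
  step?≤ (inj₁ refl) _ p = p
  step?≤ (inj₂ st) = step≤ st

  weaken : ∀ {P R s′} → s ≤ s′ → Pebbling≤ G P R s → Pebbling≤ G P R s′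
  weaken s≤s′ (k , p , k≤s) = k , p , ≤-trans k≤s s≤s′

  infixr 5 _++≤_

  _++≤_ : ∀ {P Q R} → Pebbling≤ G P Q s → Pebbling≤ G Q R s → Pebbling≤ G P R s
  _++≤_ {s = s} {Q = Q} {R} (_ , p , k≤s) q = go p k≤s
    where
    go : ∀ {P} → Pebbling G P Q k → k ≤ s → Pebbling≤ G P R s
    go done _ = q
    go (step st p) k≤s = step≤ st (m⊔n≤o⇒m≤o _ _ k≤s) (go p (m⊔n≤o⇒n≤o _ _ k≤s))

  moved : ∀ {P Q} → Step G P Q → Fin n
  moved (place v _ _) = v
  moved (remove v _ _) = v

  moved-preds : ∀ {P Q} (st : Step G P Q) → PredsIn G P (moved st)
  moved-preds (place _ _ pr) = pr
  moved-preds (remove _ _ pr) = pr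

  moved-preds′ : Loopless G → ∀ {P Q} (st : Step G P Q) → PredsIn G Q (moved st)
  moved-preds′ loopless (place v _ pr) u e = []≔-minimal _ u v (λ { refl → loopless u e }) (pr u e)
  moved-preds′ loopless (remove v _ pr) u e = []≔-minimal _ u v (λ { refl → loopless u e }) (pr u e)

  data Peak (x y : Fin n) (P Q R : Subset n) : Set where
    peak : x ∉ P → PredsIn G P x → Q ≡ P [ x ]≔ inside →
           y ∈ Q → PredsIn G Q y → R ≡ Q [ y ]≔ outside → Peak x y P Q R

  peak-right< : ∀ {x y P Q R} → Peak x y P Q R → ∣ R ∣ < ∣ Q ∣
  peak-right< (peak _ _ _ y∈ _ refl) = ≤-reflexive (1+∣p[x]≔outside∣≡∣p∣ y∈)

  toPeak : ∀ {P Q R} → Step G P Q → Step G Q R → ∣ P ∣ ≤ ∣ Q ∣ → ∣ R ∣ ≤ ∣ Q ∣ →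
           ∃₂ λ x y → Peak x y P Q R
  toPeak (place x x∉ prx) (remove y y∈ pry) _ _ = x , y , peak x∉ prx refl y∈ pry refl
  toPeak (remove x x∈ _) _ P≤Q _ = contradiction (≤-reflexive (1+∣p[x]≔outside∣≡∣p∣ x∈)) (≤⇒≯ P≤Q)
  toPeak (place _ _ _) (place y y∉ _) _ R≤Q =
    contradiction (≤-reflexive (sym (∣p[x]≔inside∣≡1+∣p∣ _ y∉))) (≤⇒≯ R≤Q)

  swap : ∀ {x y P Q R} → Peak x y P Q R → ¬ E G x y → ¬ E G y x →
         ∣ P ∣ ≤ s → ∣ R ∣ ≤ s → Pebbling≤ G P R s
  swap {s = s} {x = x} {y} {P} (peak x∉ prx refl y∈ pry refl) ¬xy ¬yx P≤s R≤s with x ≟ y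
  ... | yes refl =
    subst (λ X → Pebbling≤ G P X _) (sym (trans ([]≔-idempotent P x) ([]≔outside-∉ P x∉)))
          (done≤ P≤s)
  ... | no x≢y =
    subst (λ X → Pebbling≤ G P X s) (sym reordered)
      (step≤ (remove y y∈P pry′) P≤s
        (step≤ (place x (λ x∈ → x∉ (∈-[]≔⁻ P x∈ x≢y)) prx′) P-y≤s
          (done≤ (subst (λ X → ∣ X ∣ ≤ s) reordered R≤s))))
    where
    y∈P : y ∈ P
    y∈P = ∈-[]≔⁻ P y∈ (x≢y ∘ sym)
    pry′ : PredsIn G P y
    pry′ u e = ∈-[]≔⁻ P (pry u e) (λ { refl → ¬xy e })
    prx′ : PredsIn G (P [ y ]≔ outside) x
    prx′ u e = []≔-minimal P u y (λ { refl → ¬yx e }) (prx u e)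
    P-y≤s : ∣ P [ y ]≔ outside ∣ ≤ s
    P-y≤s = ≤-trans (n≤1+n _) (≤-trans (≤-reflexive (1+∣p[x]≔outside∣≡∣p∣ y∈P)) P≤s)
    reordered : (P [ x ]≔ inside) [ y ]≔ outside ≡ (P [ y ]≔ outside) [ x ]≔ inside
    reordered = []≔-commutes P x y x≢y

  ReachesPlacement : Subset n → Fin n → ℕ → Set
  ReachesPlacement P x k = ∃[ Q ] (x ∉ Q × PredsIn G Q x × Pebbling≤ G P (Q [ x ]≔ inside) k)

  firstPlacement : ∀ {P R x} → Pebbling G P R k → x ∉ P → x ∈ R → ReachesPlacement P x k
  firstPlacement done x∉ x∈ = contradiction x∈ x∉
  firstPlacement {P = P} {x = x} (step (place y y∉ pr) rest) x∉ x∈ with y ≟ x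
  ... | yes refl =
    P , y∉ , pr , step≤ (place y y∉ pr) (m≤m⊔n _ _) (done≤ (≤-trans (start≤ rest) (m≤n⊔m _ _)))
  ... | no y≢x =
    later (place y y∉ pr) (firstPlacement rest (λ x∈′ → x∉ (∈-[]≔⁻ P x∈′ (y≢x ∘ sym))) x∈)
    where
    later : ∀ {P′} → Step G P P′ → ReachesPlacement P′ x k → ReachesPlacement P x (∣ P ∣ ⊔ k)
    later st (Q , x∉Q , pr , p) = Q , x∉Q , pr , step≤ st (m≤m⊔n _ _) (weaken (m≤n⊔m _ _) p)
  firstPlacement {P = P} {x = x} (step (remove y y∈ pr) rest) x∉ x∈
    with firstPlacement rest (∉-[]≔outside P x∉) x∈
  ... | Q , x∉Q , prQ , p =
    Q , x∉Q , prQ , step≤ (remove y y∈ pr) (m≤m⊔n _ _) (weaken (m≤n⊔m _ _) p)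

  visitBound-one : ∀ {v} → VisitBound G v 1
  visitBound-one _ _ v∈ p = ≤-trans (x∈p⇒0<∣p∣ v∈) (end≤ p)

  prices : ∀ {v} → Pebbling≤ G ∅ ⁅ v ⁆ c → VisitBound G v c →
           PersistentPrice G v c × VisitingPrice G v c
  prices {v = v} (k , p , k≤c) bound with ≤-antisym k≤c (bound ⁅ v ⁆ k (x∈⁅x⁆ v) p)
  ... | refl = (p , λ s → bound ⁅ v ⁆ s (x∈⁅x⁆ v)) , (⁅ v ⁆ , x∈⁅x⁆ v , p) , bound

-- Transferring pebblings along maps of configurations

module Simulation {G : Graph m} {H : Graph n} (f : Subset m → Subset n)
  (∣f∣≤ : ∀ P → ∣ f P ∣ ≤ ∣ P ∣)
  (f-∅ : f ∅ ≡ ∅)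
  (f-step : ∀ {P Q} → Step G P Q → f P ≡ f Q ⊎ Step H (f P) (f Q))
  (f-peak : ∀ {x y s P Q R} → Peak {G = G} x y P Q R → ∣ f Q ∣ ≡ ∣ Q ∣ →
            ∣ f P ∣ ≤ s → ∣ f R ∣ ≤ s → Pebbling≤ H (f P) (f R) s)
  where

  -- Configurations with at most s pebbles in the image are mapped move by move; one with
  -- s + 1 is a local maximum of the pebbling, which f-peak jumps over.
  simulate : ∀ {P R} → Pebbling G P R k → k ≤ suc s → ∣ f P ∣ ≤ s → ∣ f R ∣ ≤ s →
             Pebbling≤ H (f P) (f R) s
  simulate done _ fP≤s _ = done≤ fP≤s
  simulate {s = s} (step {Q = Q} st rest) k≤ fP≤s fR≤s with ∣ f Q ∣ ≤? s
  ... | yes fQ≤s = step?≤ (f-step st) fP≤s (simulate rest (m⊔n≤o⇒n≤o _ _ k≤) fQ≤s fR≤s)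
  simulate (step st done) _ _ fR≤s | no fQ≰s = contradiction fR≤s fQ≰s
  simulate {s = s} {P = P} (step {Q = Q} st (step {Q = R′} {s = k″} st′ rest)) k≤ fP≤s fR≤s
    | no fQ≰s =
    f-peak pk tight fP≤s fR′≤s ++≤ simulate rest rest≤ fR′≤s fR≤s
    where
    Q-rest≤ : ∣ Q ∣ ⊔ k″ ≤ suc s
    Q-rest≤ = m⊔n≤o⇒n≤o ∣ P ∣ _ k≤
    Q≤ : ∣ Q ∣ ≤ suc s
    Q≤ = m⊔n≤o⇒m≤o _ _ Q-rest≤
    rest≤ : k″ ≤ suc s
    rest≤ = m⊔n≤o⇒n≤o _ _ Q-rest≤
    1+s≤fQ : suc s ≤ ∣ f Q ∣
    1+s≤fQ = ≰⇒> fQ≰s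
    1+s≤Q : suc s ≤ ∣ Q ∣
    1+s≤Q = ≤-trans 1+s≤fQ (∣f∣≤ Q)
    tight : ∣ f Q ∣ ≡ ∣ Q ∣
    tight = ≤-antisym (∣f∣≤ Q) (≤-trans Q≤ 1+s≤fQ)
    pk : Peak _ _ P Q R′
    pk = proj₂ (proj₂ (toPeak st st′ (≤-trans (m⊔n≤o⇒m≤o ∣ P ∣ _ k≤) 1+s≤Q)
                                      (≤-trans (≤-trans (start≤ rest) rest≤) 1+s≤Q)))
    fR′≤s : ∣ f R′ ∣ ≤ s
    fR′≤s = ≤-pred (≤-trans (s≤s (∣f∣≤ R′)) (≤-trans (peak-right< pk) Q≤))

  ∣f∅∣≤ : ∀ s → ∣ f ∅ ∣ ≤ s
  ∣f∅∣≤ _ = ≤-trans (∣f∣≤ ∅) (≤-trans (≤-reflexive (∣⊥∣≡0 m)) z≤n)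

  lowerBound : ∀ {R} → (∀ s → Pebbling H ∅ (f R) s → c ≤ s) →
               Pebbling G ∅ R k → ∣ f R ∣ < ∣ R ∣ → suc c ≤ k
  lowerBound {R = R} bound p fR<R with <-≤-trans fR<R (end≤ p)
  ... | s≤s fR≤s with simulate p ≤-refl (∣f∅∣≤ _) fR≤s
  ...   | k′ , q , k′≤s =
    s≤s (≤-trans (bound k′ (subst (λ X → Pebbling H X (f R) k′) f-∅ q)) k′≤s)

module Lifting {G : Graph m} {H : Graph n} (g : Subset m → Subset n)
  (∣g∣≤ : ∀ P → ∣ g P ∣ ≤ suc ∣ P ∣)
  (g-step : ∀ {P Q} → Step G P Q → Pebbling≤ H (g P) (g Q) (suc (∣ P ∣ ⊔ ∣ Q ∣)))
  where

  lift : ∀ {P R} → Pebbling G P R k → Pebbling≤ H (g P) (g R) (suc k)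
  lift {P = P} done = done≤ (∣g∣≤ P)
  lift {P = P} (step st rest) =
    weaken (s≤s (⊔-monoʳ-≤ ∣ P ∣ (start≤ rest))) (g-step st) ++≤
    weaken (s≤s (m≤n⊔m ∣ P ∣ _)) (lift rest)

module Molding (T : Graph n) where

  in′ out′ : Fin n → Fin (n + n)
  in′ v = v ↑ˡ n
  out′ v = n ↑ʳ v

  Mold⁻ : Graph (n + n)
  Mold⁻ = deleteVertex (Mold T) (moldS {n})

  into-in : ∀ {u v} → E Mold⁻ u (in′ v) → ∃[ w ] (u ≡ out′ w × E T w v)
  into-in e = go e refl refl
    where
    go : ∀ {x y u v} → MoldE T x y → x ≡ suc u → y ≡ inV v → ∃[ w ] (u ≡ out′ w × E T w v)
    go (in-out w) _ y≡ = ⊥-elim (↑ˡ≢↑ʳ _ w (sym (suc-injective y≡)))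
    go (out-in w v′ e) x≡ y≡ with ↑ˡ-injective n _ _ (suc-injective y≡) | suc-injective x≡
    ... | refl | refl = w , refl , e
    go (src-out w) () _

  into-out : ∀ {u v} → E Mold⁻ u (out′ v) → u ≡ in′ v
  into-out e = go e refl refl
    where
    go : ∀ {x y u v} → MoldE T x y → x ≡ suc u → y ≡ outV v → u ≡ in′ v
    go (in-out w) x≡ y≡ with ↑ʳ-injective n _ _ (suc-injective y≡) | suc-injective x≡
    ... | refl | refl = refl
    go (out-in w v′ e) _ y≡ = ⊥-elim (↑ˡ≢↑ʳ v′ _ (suc-injective y≡))
    go (src-out w) () _

  no-in-in : ∀ v w → ¬ E Mold⁻ (in′ v) (in′ w)
  no-in-in v w e with into-in {in′ v} e
  ... | u , eq , _ = ↑ˡ≢↑ʳ v u eq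

  preds-in : ∀ {P v} → (∀ u → E T u v → out′ u ∈ P) → PredsIn Mold⁻ P (in′ v)
  preds-in pr u e with into-in {u} e
  ... | w , refl , e′ = pr w e′

  preds-out : ∀ {P v} → in′ v ∈ P → PredsIn Mold⁻ P (out′ v)
  preds-out i∈ u e rewrite into-out {u} e = i∈

  lower-preds : ∀ {b X i} → PredsIn (Mold T) (b ∷ X) (suc i) → PredsIn Mold⁻ X i
  lower-preds pr u e = drop-there (pr (suc u) e)

  raise-preds : ∀ {X i} → PredsIn Mold⁻ X i → PredsIn (Mold T) (inside ∷ X) (suc i)
  raise-preds pr zero _ = here
  raise-preds pr (suc u) e = there (pr u e)

  shadow-preds : ∀ {P v} → PredsIn Mold⁻ P (in′ v) → PredsIn T (shadow n P) v
  shadow-preds {v = v} pr u e = ∈-shadowʳ (pr (out′ u) (out-in u v e))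

  -- Upper bounds

  raise : ∀ {X Y} → Step Mold⁻ X Y → Step (Mold T) (inside ∷ X) (inside ∷ Y)
  raise (place i i∉ pr) = place (suc i) (i∉ ∘ drop-there) (raise-preds pr)
  raise (remove i i∈ pr) = remove (suc i) (there i∈) (raise-preds pr)

  guarded-step : ∀ {X Y} → Step Mold⁻ X Y →
                 Pebbling≤ (Mold T) (outside ∷ X) (outside ∷ Y) (suc (∣ X ∣ ⊔ ∣ Y ∣))
  guarded-step st =
    step≤ (place zero (λ ()) (λ _ ())) (m≤n⇒m≤1+n (m≤m⊔n _ _))
      (step≤ (raise st) (s≤s (m≤m⊔n _ _))
        (step≤ (remove zero here (λ _ ())) (s≤s (m≤n⊔m _ _))
          (done≤ (m≤n⇒m≤1+n (m≤n⊔m _ _)))))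

  module Guarding = Lifting (outside ∷_) (λ X → n≤1+n ∣ X ∣) guarded-step

  out-step : ∀ {a P Q} (st : Step T P Q) → moved st ∈ a → Step Mold⁻ (a ++ P) (a ++ Q)
  out-step {a} {P} (place v v∉ _) v∈a =
    subst (Step Mold⁻ _) ([]≔-++-↑ʳ a P v) (place (out′ v) (v∉ ∘ ∈-++⁻ʳ a) (preds-out (∈-++⁺ˡ v∈a)))
  out-step {a} {P} (remove v v∈ _) v∈a =
    subst (Step Mold⁻ _) ([]≔-++-↑ʳ a P v) (remove (out′ v) (∈-++⁺ʳ a v∈) (preds-out (∈-++⁺ˡ v∈a)))

  replay-step : Loopless T → ∀ {P Q} → Step T P Q →
                Pebbling≤ Mold⁻ (∅ ++ P) (∅ ++ Q) (suc (∣ P ∣ ⊔ ∣ Q ∣))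
  replay-step loopless {P} {Q} st =
    step≤ enter ∣∅++P∣≤
      (step≤ (out-step st ([]≔-updates ∅ v)) ∣a++P∣≤
        (step≤ leave ∣a++Q∣≤
          (done≤ ∣∅++Q∣≤)))
    where
    v : Fin n
    v = moved st
    a : Subset n
    a = ∅ [ v ]≔ inside
    enter : Step Mold⁻ (∅ ++ P) (a ++ P)
    enter = subst (Step Mold⁻ _) ([]≔-++-↑ˡ ∅ P v)
      (place (in′ v) (∉⊥ ∘ ∈-++⁻ˡ ∅) (preds-in (λ u e → ∈-++⁺ʳ ∅ (moved-preds st u e))))
    leave : Step Mold⁻ (a ++ Q) (∅ ++ Q)
    leave = subst (Step Mold⁻ _)
      (trans ([]≔-++-↑ˡ a Q v) (cong (_++ Q) (trans ([]≔-idempotent ∅ v) ([]≔outside-∉ ∅ ∉⊥))))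
      (remove (in′ v) (∈-++⁺ˡ ([]≔-updates ∅ v))
              (preds-in (λ u e → ∈-++⁺ʳ a (moved-preds′ loopless st u e))))
    ∣∅++P∣≤ : ∣ ∅ {n} ++ P ∣ ≤ suc (∣ P ∣ ⊔ ∣ Q ∣)
    ∣∅++P∣≤ = ≤-trans (≤-reflexive (∣⊥++p∣≡∣p∣ n P)) (m≤n⇒m≤1+n (m≤m⊔n _ _))
    ∣a++P∣≤ : ∣ a ++ P ∣ ≤ suc (∣ P ∣ ⊔ ∣ Q ∣)
    ∣a++P∣≤ = ≤-trans (≤-reflexive (∣⊥[x]≔inside++p∣≡1+∣p∣ v P)) (s≤s (m≤m⊔n _ _))
    ∣a++Q∣≤ : ∣ a ++ Q ∣ ≤ suc (∣ P ∣ ⊔ ∣ Q ∣)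
    ∣a++Q∣≤ = ≤-trans (≤-reflexive (∣⊥[x]≔inside++p∣≡1+∣p∣ v Q)) (s≤s (m≤n⊔m _ _))
    ∣∅++Q∣≤ : ∣ ∅ {n} ++ Q ∣ ≤ suc (∣ P ∣ ⊔ ∣ Q ∣)
    ∣∅++Q∣≤ = ≤-trans (≤-reflexive (∣⊥++p∣≡∣p∣ n Q)) (m≤n⇒m≤1+n (m≤n⊔m _ _))

  module Replaying (loopless : Loopless T) =
    Lifting (∅ ++_) (λ P → ≤-trans (≤-reflexive (∣⊥++p∣≡∣p∣ n P)) (n≤1+n _)) (replay-step loopless)

  mold⁻-upper : ∀ {t} → Loopless T → Pebbling T ∅ ⁅ t ⁆ c → Pebbling≤ Mold⁻ ∅ ⁅ out′ t ⁆ (suc c)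
  mold⁻-upper {t = t} loopless p =
    subst₂ (λ X Y → Pebbling≤ Mold⁻ X Y _) (⊥++⊥≡⊥ n n) (⊥++⁅x⁆≡⁅m↑ʳx⁆ n t)
           (Replaying.lift loopless p)

  mold-upper : ∀ {t} → Loopless T → Pebbling T ∅ ⁅ t ⁆ c →
               Pebbling≤ (Mold T) ∅ ⁅ outV t ⁆ (suc (suc c))
  mold-upper loopless p with mold⁻-upper loopless p
  ... | _ , q , k≤ = weaken (s≤s k≤) (Guarding.lift q)

  -- Lower bounds

  tail-step : ∀ {P Q} → Step (Mold T) P Q → tail P ≡ tail Q ⊎ Step Mold⁻ (tail P) (tail Q)
  tail-step {_ ∷ _} (place zero _ _) = inj₁ refl
  tail-step {_ ∷ _} (remove zero _ _) = inj₁ refl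
  tail-step {_ ∷ _} (place (suc i) i∉ pr) = inj₂ (place i (i∉ ∘ there) (lower-preds pr))
  tail-step {_ ∷ _} (remove (suc i) i∈ pr) = inj₂ (remove i (drop-there i∈) (lower-preds pr))

  -- At a peak that keeps s unpebbled, both moves are on in-vertices, which are never adjacent.
  tail-peak : ∀ {x y s P Q R} → Peak {G = Mold T} x y P Q R → ∣ tail Q ∣ ≡ ∣ Q ∣ →
              ∣ tail P ∣ ≤ s → ∣ tail R ∣ ≤ s → Pebbling≤ Mold⁻ (tail P) (tail R) s
  tail-peak {zero} {P = _ ∷ _} (peak _ _ refl _ _ _) tight _ _ = ⊥-elim (1+n≢n (sym tight))
  tail-peak {suc _} {P = inside ∷ _} (peak _ _ refl _ _ _) tight _ _ = ⊥-elim (1+n≢n (sym tight))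
  tail-peak {suc _} {zero} {P = outside ∷ _} (peak _ _ refl () _ _) _ _ _
  tail-peak {suc x} {suc y} {P = outside ∷ _} (peak x∉ prx refl y∈ pry refl) _ P≤s R≤s
    with split n n x | split n n y
  ... | right v | _ with prx zero (src-out v)
  ...   | ()
  tail-peak (peak x∉ prx refl y∈ pry refl) _ P≤s R≤s | left v | right w with pry zero (src-out w)
  ...   | ()
  tail-peak (peak x∉ prx refl y∈ pry refl) _ P≤s R≤s | left v | left w =
    swap (peak (x∉ ∘ there) (lower-preds prx) refl (drop-there y∈) (lower-preds pry) refl)
         (no-in-in v w) (no-in-in w v) P≤s R≤s

  module Unguarding = Simulation tail ∣tail∣≤ refl tail-step tail-peak

  tight⇒out∉ : ∀ {Q v} → ∣ shadow n Q ∣ ≡ ∣ Q ∣ → in′ v ∈ Q → out′ v ∉ Q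
  tight⇒out∉ tight i∈ o∈ = <-irrefl tight (∣shadow∣< i∈ o∈)

  shadow-step : ∀ {P Q} → Step Mold⁻ P Q →
                shadow n P ≡ shadow n Q ⊎ Step T (shadow n P) (shadow n Q)
  shadow-step {P} (place i i∉ pr) with split n n i
  ... | right v = inj₁ (sym (shadow-[↑ʳ]≔-covered _ (pr (in′ v) (in-out v))))
  ... | left v with out′ v ∈? P
  ...   | yes o∈ = inj₁ (sym (shadow-[↑ˡ]≔-covered _ o∈))
  ...   | no o∉ =
    inj₂ (subst (Step T _) (sym (shadow-[↑ˡ]≔ _ o∉)) (place v (∉-shadow i∉ o∉) (shadow-preds pr)))
  shadow-step {P} (remove i i∈ pr) with split n n i
  ... | right v = inj₁ (sym (shadow-[↑ʳ]≔-covered _ (pr (in′ v) (in-out v))))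
  ... | left v with out′ v ∈? P
  ...   | yes o∈ = inj₁ (sym (shadow-[↑ˡ]≔-covered _ o∈))
  ...   | no o∉ =
    inj₂ (subst (Step T _) (sym (shadow-[↑ˡ]≔ _ o∉)) (remove v (∈-shadowˡ i∈) (shadow-preds pr)))

  -- At a peak no vertex has both copies pebbled, so both moves are on in-vertices; an edge
  -- between them would force one of the two vertices to have both copies pebbled.
  shadow-peak : ∀ {x y s P Q R} → Peak {G = Mold⁻} x y P Q R → ∣ shadow n Q ∣ ≡ ∣ Q ∣ →
                ∣ shadow n P ∣ ≤ s → ∣ shadow n R ∣ ≤ s → Pebbling≤ T (shadow n P) (shadow n R) s
  shadow-peak {x} {y} {P = P} (peak x∉ prx refl y∈ pry refl) tight P≤s R≤s
    with split n n x | split n n y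
  ... | right v | _ =
    ⊥-elim (tight⇒out∉ tight ([]≔-minimal P _ _ (↑ˡ≢↑ʳ v v) (prx (in′ v) (in-out v)))
                             ([]≔-updates P (out′ v)))
  ... | left v | right w = ⊥-elim (tight⇒out∉ tight (pry (in′ w) (in-out w)) y∈)
  ... | left v | left w =
    swap (peak (∉-shadow x∉ outv∉P) (shadow-preds prx) (shadow-[↑ˡ]≔ _ outv∉P)
               (∈-shadowˡ y∈) (shadow-preds pry) (shadow-[↑ˡ]≔ _ outw∉Q))
         (λ e → outv∉Q (pry (out′ v) (out-in v w e)))
         (λ e → outw∉Q ([]≔-minimal P _ _ (↑ˡ≢↑ʳ v w ∘ sym) (prx (out′ w) (out-in w v e))))
         P≤s R≤s
    where
    outv∉Q : out′ v ∉ P [ in′ v ]≔ inside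
    outv∉Q = tight⇒out∉ tight ([]≔-updates P (in′ v))
    outv∉P : out′ v ∉ P
    outv∉P o∈ = outv∉Q ([]≔-minimal P _ _ (↑ˡ≢↑ʳ v v ∘ sym) o∈)
    outw∉Q : out′ w ∉ P [ in′ v ]≔ inside
    outw∉Q = tight⇒out∉ tight y∈

  module Shadowing = Simulation (shadow n) (∣shadow∣≤ {n}) (shadow-∅ n) shadow-step shadow-peak

  both-copies-bound : ∀ {t R} → VisitBound T t c →
                      Pebbling Mold⁻ ∅ R k → in′ t ∈ R → out′ t ∈ R → suc c ≤ k
  both-copies-bound bound p i∈ o∈ =
    Shadowing.lowerBound (λ s → bound _ s (∈-shadowˡ i∈)) p (∣shadow∣< i∈ o∈)

  mold⁻-bound : ∀ {t} → VisitBound T t c → VisitBound Mold⁻ (out′ t) (suc c)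
  mold⁻-bound {t = t} bound _ _ o∈ p with firstPlacement p ∉⊥ o∈
  ... | Q , _ , pr , _ , q , k≤ =
    ≤-trans (both-copies-bound bound q ([]≔-minimal Q _ _ (↑ˡ≢↑ʳ t t) (pr (in′ t) (in-out t)))
                                       ([]≔-updates Q (out′ t)))
            k≤

  mold-bound : ∀ {t} → VisitBound T t c → VisitBound (Mold T) (outV t) (suc (suc c))
  mold-bound {t = t} bound _ _ o∈ p with firstPlacement p ∉⊥ o∈
  ... | Q , _ , pr , _ , q , k≤ =
    ≤-trans (Unguarding.lowerBound (λ _ r → both-copies-bound bound r i∈ o∈′) q (∣tail∣< s∈)) k≤
    where
    s∈ : zero ∈ Q [ outV t ]≔ inside
    s∈ = []≔-minimal Q _ _ (λ ()) (pr zero (src-out t))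
    i∈ : in′ t ∈ tail (Q [ outV t ]≔ inside)
    i∈ = ∈-tail ([]≔-minimal Q _ _ (↑ˡ≢↑ʳ t t ∘ suc-injective) (pr (inV t) (in-out t)))
    o∈′ : out′ t ∈ tail (Q [ outV t ]≔ inside)
    o∈′ = ∈-tail ([]≔-updates Q (outV t))

  mold-prices : ∀ {t} → Loopless T → Pebbling T ∅ ⁅ t ⁆ c → VisitBound T t c →
    (PersistentPrice (Mold T) (outV t) (suc (suc c)) × VisitingPrice (Mold T) (outV t) (suc (suc c)))
    × (PersistentPrice Mold⁻ (out′ t) (suc c) × VisitingPrice Mold⁻ (out′ t) (suc c))
  mold-prices loopless p bound =
    prices (mold-upper loopless p) (mold-bound bound) ,
    prices (mold⁻-upper loopless p) (mold⁻-bound bound)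

edge-upper : Pebbling≤ singleEdgeGraph ∅ ⁅ suc zero ⁆ 2
edge-upper =
  step≤ (place zero (λ ()) (λ _ ())) z≤n
    (step≤ (place (suc zero) (λ { (there ()) }) (λ { zero edge → here })) (s≤s z≤n)
      (step≤ (remove zero here (λ _ ())) ≤-refl
        (done≤ (s≤s z≤n))))

edge-bound : VisitBound singleEdgeGraph (suc zero) 2
edge-bound _ _ x∈ p with firstPlacement p ∉⊥ x∈
... | _ ∷ _ ∷ [] , _ , pr , _ , q , k≤ with pr zero edge
...   | here = ≤-trans (end≤ q) k≤

lemma6p8 : ∀ (r : ℕ) {m} (H : Graph (suc m)) (a b : Fin (suc m)) →
    Turnpike r H a b →
    (PersistentPrice H b (r + 2) × VisitingPrice H b (r + 2))
    × (∀ b′ → punchIn a b′ ≡ b →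
         PersistentPrice (deleteVertex H a) b′ (r + 1)
         × VisitingPrice (deleteVertex H a) b′ (r + 1))
lemma6p8 _ _ _ _ toll0 =
  prices edge-upper edge-bound ,
  λ { zero refl → prices (step≤ (place zero (λ ()) (λ _ ())) z≤n (done≤ ≤-refl)) visitBound-one }
lemma6p8 _ _ _ _ (tollS {r} T t acyclic _ visiting persistent _) rewrite +-comm r 2 | +-comm r 1
  with Molding.mold-prices T (λ v e → acyclic v [ e ]⁺) (proj₁ persistent) (proj₂ visiting)
... | mold , mold⁻ = mold , λ { _ refl → mold⁻ }
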